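{- Let $p$ be an odd prime, $k$ a positive integer, $q=p^k$, and let $f:\mathbb{F}_q\to\mathbb{F}_q$ be the permutation defined by $f(0)=1$, $f(1)=0$, and $f(x)=1/x$ for $x\notin\{0,1\}$. Then $f$ destroys every nonconstant 3-term arithmetic progression in $\mathbb{F}_q$ except the following: if $p=3$, the orderings of $\{ -1,0,1\}$ (all of which are arithmetic progressions when $p=3$); if $p>3$, the progressions $(0,\tfrac32,3)$, $(3,\tfrac32,0)$, $(\tfrac13,\tfrac23,1)$ and $(1,\tfrac23,\tfrac13)$.
   Context: A nonconstant 3-term arithmetic progression (AP) in $\mathbb{F}_q$ is an ordered triple $(a,b,c)\in\mathbb{F}_q^3$ with $b-a=c-b\neq 0$. A permutation $\pi$ of $\mathbb{F}_q$ destroys such an AP $(a,b,c)$ if $\pi(b)-\pi(a)\neq\pi(c)-\pi(b)$, i.e. $(\pi(a),\pi(b),\pi(c))$ is not an AP. Note that $\pi$ destroys $(a,b,c)$ if and only if it destroys the reversed AP $(c,b,a)$. -}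

module Defs where

open import Level using (0ℓ)
open import Data.Nat using (ℕ; suc; _^_)
open import Data.Fin using (Fin)
open import Data.Product using (Σ; ∃; _×_; _,_; proj₁)
open import Data.Sum using (_⊎_)
open import Relation.Nullary using (¬_; Dec; yes; no)
open import Relation.Binary.PropositionalEquality using (_≡_; _≢_)
open import Relation.Binary.Definitions using (DecidableEquality)
open import Algebra.Structures using (IsCommutativeRing)
open import Function.Bundles using (_↔_)

record Field : Set₁ where
  infixl 6 _+_ _-_
  infixl 7 _*_
  field
    Carrier : Set
    _+_ _*_ : Carrier → Carrier → Carrier
    -_      : Carrier → Carrier
    0# 1#   : Carrier
    isCommutativeRing : IsCommutativeRing _≡_ _+_ _*_ -_ 0# 1#
    0≢1     : 0# ≢ 1#
    inverse : ∀ x → x ≢ 0# → Σ Carrier (λ y → x * y ≡ 1#)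
    _≟_     : DecidableEquality Carrier

  _-_ : Carrier → Carrier → Carrier
  x - y = x + (- y)

  2# 3# : Carrier
  2# = 1# + 1#
  3# = 1# + 1# + 1#

  inv : (x : Carrier) → x ≢ 0# → Carrier
  inv x nz = proj₁ (inverse x nz)

HasSize : Field → ℕ → Set
HasSize F q = Field.Carrier F ↔ Fin q

module _ (F : Field) where
  open Field F

  fmap : Carrier → Carrier
  fmap x with x ≟ 0#
  ... | yes _ = 1#
  ... | no x≢0 with x ≟ 1#
  ...   | yes _ = 0#
  ...   | no _  = inv x x≢0

  IsNonconstAP : Carrier → Carrier → Carrier → Set
  IsNonconstAP a b c = (b - a ≡ c - b) × (b - a ≢ 0#)

  Destroys : (Carrier → Carrier) → Carrier → Carrier → Carrier → Set
  Destroys π a b c = π b - π a ≢ π c - π b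

  OrderingOfMinus1-0-1 : Carrier → Carrier → Carrier → Set
  OrderingOfMinus1-0-1 a b c =
      (a ≡ - 1# × b ≡ 0# × c ≡ 1#)
    ⊎ (a ≡ - 1# × b ≡ 1# × c ≡ 0#)
    ⊎ (a ≡ 0# × b ≡ - 1# × c ≡ 1#)
    ⊎ (a ≡ 0# × b ≡ 1# × c ≡ - 1#)
    ⊎ (a ≡ 1# × b ≡ - 1# × c ≡ 0#)
    ⊎ (a ≡ 1# × b ≡ 0# × c ≡ - 1#)

  -- (0,3/2,3), (3,3/2,0), (1/3,2/3,1), (1,2/3,1/3), written via
  -- defining equations (2 and 3 are invertible when p > 3):
  -- b = 3/2 iff 2*b = 3, a = 1/3 iff 3*a = 1, b = 2/3 iff 3*b = 2.
  Exceptional>3 : Carrier → Carrier → Carrier → Set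
  Exceptional>3 a b c =
      (a ≡ 0# × 2# * b ≡ 3# × c ≡ 3#)
    ⊎ (a ≡ 3# × 2# * b ≡ 3# × c ≡ 0#)
    ⊎ (3# * a ≡ 1# × 3# * b ≡ 2# × c ≡ 1#)
    ⊎ (a ≡ 1# × 3# * b ≡ 2# × 3# * c ≡ 1#)

-- f(x) = 1/x off {0, 1} keeps an AP (a, b, c) iff f(a) + f(c) = 2 f(b). Split according to which
-- of a, b, c lie in {0, 1}; at the other points x f(x) = 1. In each case these equations together
-- with a + c = 2b form a small polynomial system, and an explicit linear combination of them
-- (checked by the ring solver) either yields a contradiction, or forces 3 = 0 and an ordering of
-- {-1, 0, 1}, or forces 3 ≠ 0 and one of the exceptional progressions. Reversing the progression
-- halves the work. Summing the translation by 1 over the field shows that its size p^k, hence p,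
-- is 0 in it, so by Bézout 2 ≠ 0, and 3 = 0 exactly when p = 3.
module Submission where

open import Defs
open import Algebra.Bundles using (CommutativeRing)
open import Data.Empty using (⊥; ⊥-elim)
open import Data.Fin.Base using (Fin)
open import Data.Integer.Base as ℤ using (ℤ; -[1+_]; _⊖_; _◃_; sign; ∣_∣)
import Data.Integer.Properties as ℤ
open import Data.Maybe.Base using (Maybe; just; nothing)
open import Data.Nat using (ℕ; _^_; _≥_; _>_)
import Data.Nat.Base as ℕ
import Data.Nat.Properties as ℕ
open import Data.Nat.Coprimality using (Coprime; coprime-Bézout; prime⇒coprime)
open import Data.Nat.GCD using (module Bézout)
open import Data.Nat.Primality using (Prime; prime⇒nonTrivial)
open import Data.Product using (_×_; _,_; proj₂)
open import Data.Sign.Base as Sign using (Sign)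
open import Data.Sum using (_⊎_; inj₁; inj₂)
open import Function.Base using (_⟨_⟩_)
open import Function.Bundles using (_⇔_; _↔_; Inverse; Equivalence; mk↔ₛ′; mk⇔)
open import Function.Properties.Equivalence using () renaming (trans to ⇔-trans)
open import Function.Properties.Inverse using (↔-sym; ↔-trans)
open import Level using (0ℓ)
open import Relation.Binary.PropositionalEquality as ≡ using (_≡_; _≢_; ≢-sym; module ≡-Reasoning)
open import Relation.Nullary using (¬_; yes; no)
open import Relation.Nullary.Decidable using (decidable-stable)

module IntegerCoefficients {c ℓ} (R : CommutativeRing c ℓ) where
  open CommutativeRing R
  open import Algebra.Properties.Ring ring using (-0#≈0#; -‿involutive; -‿+-comm; -‿distribˡ-*; -‿distribʳ-*)
  open import Algebra.Properties.Semiring.Mult.TCOptimised semiring using (×-homo-+; ×1-homo-*) renaming (_×_ to _×′_)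
  open import Algebra.Solver.Ring.AlmostCommutativeRing using (fromCommutativeRing; _-Raw-AlmostCommutative⟶_)
  open import Relation.Binary.Reasoning.Setoid setoid

  -- The left-associated multiple makes fromℕ 2 and fromℕ 3 reduce to 1# + 1# and 1# + 1# + 1#,
  -- so the solver's integer constants are definitionally a field's 2# and 3#.
  fromℕ : ℕ → Carrier
  fromℕ n = n ×′ 1#

  fromℕ-+ : ∀ m n → fromℕ (m ℕ.+ n) ≈ fromℕ m + fromℕ n
  fromℕ-+ = ×-homo-+ 1#

  fromℕ-* : ∀ m n → fromℕ (m ℕ.* n) ≈ fromℕ m * fromℕ n
  fromℕ-* = ×1-homo-*

  signed : Sign → Carrier → Carrier
  signed Sign.+ x = x
  signed Sign.- x = - x

  fromℤ : ℤ → Carrier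
  fromℤ i = signed (sign i) (fromℕ ∣ i ∣)

  signed-0# : ∀ s → signed s 0# ≈ 0#
  signed-0# Sign.+ = refl
  signed-0# Sign.- = -0#≈0#

  signed-* : ∀ s t x y → signed (s Sign.* t) (x * y) ≈ signed s x * signed t y
  signed-* Sign.+ Sign.+ x y = refl
  signed-* Sign.+ Sign.- x y = -‿distribʳ-* x y
  signed-* Sign.- Sign.+ x y = -‿distribˡ-* x y
  signed-* Sign.- Sign.- x y = begin
    x * y         ≈⟨ -‿involutive (x * y) ⟨
    - - (x * y)   ≈⟨ -‿cong (-‿distribˡ-* x y) ⟩
    - (- x * y)   ≈⟨ -‿distribʳ-* (- x) y ⟩
    - x * - y     ∎

  fromℤ-◃ : ∀ s n → fromℤ (s ◃ n) ≈ signed s (fromℕ n)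
  fromℤ-◃ s        ℕ.zero    = sym (signed-0# s)
  fromℤ-◃ Sign.+ (ℕ.suc n) = refl
  fromℤ-◃ Sign.- (ℕ.suc n) = refl

  [z+x]-[z+y]≈x-y : ∀ z x y → (z + x) - (z + y) ≈ x - y
  [z+x]-[z+y]≈x-y z x y = begin
    (z + x) - (z + y)         ≈⟨ +-congˡ (-‿+-comm z y) ⟨
    (z + x) + (- z + - y)     ≈⟨ +-congʳ (+-comm z x) ⟩
    (x + z) + (- z + - y)     ≈⟨ +-assoc x z _ ⟩
    x + (z + (- z + - y))     ≈⟨ +-congˡ (+-assoc z (- z) (- y)) ⟨
    x + ((z - z) + - y)       ≈⟨ +-congˡ (+-congʳ (-‿inverseʳ z)) ⟩
    x + (0# + - y)            ≈⟨ +-congˡ (+-identityˡ (- y)) ⟩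
    x - y                     ∎

  fromℤ-⊖ : ∀ m n → fromℤ (m ⊖ n) ≈ fromℕ m - fromℕ n
  fromℤ-⊖ m         ℕ.zero    = sym (trans (+-congˡ -0#≈0#) (+-identityʳ (fromℕ m)))
  fromℤ-⊖ ℕ.zero    (ℕ.suc n) = sym (+-identityˡ _)
  fromℤ-⊖ (ℕ.suc m) (ℕ.suc n) = begin
    fromℤ (ℕ.suc m ⊖ ℕ.suc n)                 ≡⟨ ≡.cong fromℤ (ℤ.[1+m]⊖[1+n]≡m⊖n m n) ⟩
    fromℤ (m ⊖ n)                             ≈⟨ fromℤ-⊖ m n ⟩
    fromℕ m - fromℕ n                         ≈⟨ [z+x]-[z+y]≈x-y 1# (fromℕ m) (fromℕ n) ⟨
    (1# + fromℕ m) - (1# + fromℕ n)           ≈⟨ +-cong (fromℕ-+ 1 m) (-‿cong (fromℕ-+ 1 n)) ⟨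
    fromℕ (ℕ.suc m) - fromℕ (ℕ.suc n)         ∎

  fromℤ-+ : ∀ i j → fromℤ (i ℤ.+ j) ≈ fromℤ i + fromℤ j
  fromℤ-+ (ℤ.+ m)  (ℤ.+ n)  = fromℕ-+ m n
  fromℤ-+ (ℤ.+ m)  -[1+ n ] = fromℤ-⊖ m (ℕ.suc n)
  fromℤ-+ -[1+ m ] (ℤ.+ n)  = trans (fromℤ-⊖ n (ℕ.suc m)) (+-comm _ _)
  fromℤ-+ -[1+ m ] -[1+ n ] = begin
    - fromℕ (ℕ.suc (ℕ.suc (m ℕ.+ n)))        ≡⟨ ≡.cong (λ k → - fromℕ (ℕ.suc k)) (ℕ.+-suc m n) ⟨
    - fromℕ (ℕ.suc m ℕ.+ ℕ.suc n)            ≈⟨ -‿cong (fromℕ-+ (ℕ.suc m) (ℕ.suc n)) ⟩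
    - (fromℕ (ℕ.suc m) + fromℕ (ℕ.suc n))    ≈⟨ -‿+-comm _ _ ⟨
    - fromℕ (ℕ.suc m) + - fromℕ (ℕ.suc n)    ∎

  fromℤ-* : ∀ i j → fromℤ (i ℤ.* j) ≈ fromℤ i * fromℤ j
  fromℤ-* i j = begin
    fromℤ (s ◃ ∣ i ∣ ℕ.* ∣ j ∣)                  ≈⟨ fromℤ-◃ s (∣ i ∣ ℕ.* ∣ j ∣) ⟩
    signed s (fromℕ (∣ i ∣ ℕ.* ∣ j ∣))            ≈⟨ signed-cong s (fromℕ-* ∣ i ∣ ∣ j ∣) ⟩
    signed s (fromℕ ∣ i ∣ * fromℕ ∣ j ∣)          ≈⟨ signed-* (sign i) (sign j) _ _ ⟩
    fromℤ i * fromℤ j                            ∎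
    where
    s = sign i Sign.* sign j
    signed-cong : ∀ s {x y} → x ≈ y → signed s x ≈ signed s y
    signed-cong Sign.+ x≈y = x≈y
    signed-cong Sign.- x≈y = -‿cong x≈y

  fromℤ-neg : ∀ i → fromℤ (ℤ.- i) ≈ - fromℤ i
  fromℤ-neg (ℤ.+ ℕ.zero)  = sym -0#≈0#
  fromℤ-neg (ℤ.+ ℕ.suc n) = refl
  fromℤ-neg -[1+ n ]      = sym (-‿involutive _)

  fromℤ-homomorphism : ℤ.+-*-rawRing -Raw-AlmostCommutative⟶ fromCommutativeRing R
  fromℤ-homomorphism = record
    { ⟦_⟧    = fromℤ
    ; +-homo = fromℤ-+
    ; *-homo = fromℤ-*
    ; -‿homo = fromℤ-neg
    ; 0-homo = refl
    ; 1-homo = refl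
    }

  fromℤ-≟ : ∀ i j → Maybe (fromℤ i ≈ fromℤ j)
  fromℤ-≟ i j with i ℤ.≟ j
  ... | yes ≡.refl = just refl
  ... | no _       = nothing

  open import Algebra.Solver.Ring ℤ.+-*-rawRing (fromCommutativeRing R) fromℤ-homomorphism fromℤ-≟ public

odd-prime⇒2<p : ∀ {p} → Prime p → p ≢ 2 → 2 ℕ.< p
odd-prime⇒2<p {p} p-prime p≢2 = ℕ.≤∧≢⇒< (ℕ.nonTrivial⇒n>1 p {{prime⇒nonTrivial p-prime}}) (≢-sym p≢2)

pattern ⟨-1,0,1⟩ eqs = inj₁ eqs
pattern ⟨-1,1,0⟩ eqs = inj₂ (inj₁ eqs)
pattern ⟨0,-1,1⟩ eqs = inj₂ (inj₂ (inj₁ eqs))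
pattern ⟨0,1,-1⟩ eqs = inj₂ (inj₂ (inj₂ (inj₁ eqs)))
pattern ⟨1,-1,0⟩ eqs = inj₂ (inj₂ (inj₂ (inj₂ (inj₁ eqs))))
pattern ⟨1,0,-1⟩ eqs = inj₂ (inj₂ (inj₂ (inj₂ (inj₂ eqs))))

pattern ⟨0,3/2,3⟩ eqs   = inj₁ eqs
pattern ⟨3,3/2,0⟩ eqs   = inj₂ (inj₁ eqs)
pattern ⟨1/3,2/3,1⟩ eqs = inj₂ (inj₂ (inj₁ eqs))
pattern ⟨1,2/3,1/3⟩ eqs = inj₂ (inj₂ (inj₂ eqs))

module _ (F : Field) where
  open Field F
  open ≡ using (refl; sym; trans; cong; cong₂)
  open ≡-Reasoning

  commutativeRing : CommutativeRing 0ℓ 0ℓ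
  commutativeRing = record { isCommutativeRing = isCommutativeRing }

  open CommutativeRing commutativeRing
    using (+-comm; +-assoc; +-identityˡ; +-identityʳ; -‿inverseˡ; -‿inverseʳ; *-comm; *-assoc; *-identityˡ; zeroˡ; zeroʳ; *-identityʳ;
           +-group; +-commutativeMonoid)
  open IntegerCoefficients commutativeRing public using (fromℕ)
  open IntegerCoefficients commutativeRing
    using (fromℕ-+; fromℕ-*; Polynomial; solve; _:=_; _:+_; _:-_; _:*_; :-_; con)
  open import Algebra.Properties.Group +-group using (x∙y⁻¹≈ε⇒x≈y; identityʳ-unique)

  1≢0 : 1# ≢ 0#
  1≢0 1≡0 = 0≢1 (sym 1≡0)

  x*y≡0⇒x≡0⊎y≡0 : ∀ {x y} → x * y ≡ 0# → x ≡ 0# ⊎ y ≡ 0#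
  x*y≡0⇒x≡0⊎y≡0 {x} {y} xy≡0 with x ≟ 0#
  ... | yes x≡0 = inj₁ x≡0
  ... | no x≢0  = inj₂ (begin
    y                      ≡⟨ *-identityˡ y ⟨
    1# * y                 ≡⟨ cong (_* y) (trans (*-comm _ x) (proj₂ (inverse x x≢0))) ⟨
    (inv x x≢0 * x) * y    ≡⟨ *-assoc _ x y ⟩
    inv x x≢0 * (x * y)    ≡⟨ cong (inv x x≢0 *_) xy≡0 ⟩
    inv x x≢0 * 0#         ≡⟨ zeroʳ _ ⟩
    0#                     ∎)

  x≢x+1 : ∀ {x} → x ≢ x + 1#
  x≢x+1 {x} x≡x+1 = 1≢0 (identityʳ-unique x 1# (sym x≡x+1))

  x*y≢0 : ∀ {x y} → x ≢ 0# → y ≢ 0# → x * y ≢ 0#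
  x*y≢0 x≢0 y≢0 xy≡0 with x*y≡0⇒x≡0⊎y≡0 xy≡0
  ... | inj₁ x≡0 = x≢0 x≡0
  ... | inj₂ y≡0 = y≢0 y≡0

  infixl 6 _⊕_ _⊝_
  infixr 7 _⊛_

  -- Linear combinations: an equation x ≡ y enters as δ of it, a proof of x - y ≡ 0#,
  -- and by-combination closes x ≡ y once solve identifies x - y with such a combination.
  δ : ∀ {x y} → x ≡ y → x - y ≡ 0#
  δ {x} x≡y = trans (cong (λ y → x - y) (sym x≡y)) (-‿inverseʳ x)

  _⊕_ : ∀ {x y} → x ≡ 0# → y ≡ 0# → x + y ≡ 0#
  x≡0 ⊕ y≡0 = trans (cong₂ _+_ x≡0 y≡0) (+-identityʳ 0#)

  ⊖_ : ∀ {x} → x ≡ 0# → - x ≡ 0#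
  ⊖ x≡0 = trans (cong -_ x≡0) (trans (sym (+-identityˡ (- 0#))) (-‿inverseʳ 0#))

  _⊝_ : ∀ {x y} → x ≡ 0# → y ≡ 0# → x - y ≡ 0#
  x≡0 ⊝ y≡0 = x≡0 ⊕ ⊖ y≡0

  _⊛_ : ∀ k {x} → x ≡ 0# → k * x ≡ 0#
  k ⊛ x≡0 = trans (cong (k *_) x≡0) (zeroʳ k)

  by-combination : ∀ {x y z} → x - y ≡ z → z ≡ 0# → x ≡ y
  by-combination x-y≡z z≡0 = x∙y⁻¹≈ε⇒x≈y _ _ (trans x-y≡z z≡0)

  by-scaled-combination : ∀ {k x y z} → k ≢ 0# → k * (x - y) ≡ z → z ≡ 0# → x ≡ y
  by-scaled-combination k≢0 k[x-y]≡z z≡0 with x*y≡0⇒x≡0⊎y≡0 (trans k[x-y]≡z z≡0)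
  ... | inj₁ k≡0   = ⊥-elim (k≢0 k≡0)
  ... | inj₂ x-y≡0 = x∙y⁻¹≈ε⇒x≈y _ _ x-y≡0

  x≢y⇒x-y≢0 : ∀ {x y} → x ≢ y → x - y ≢ 0#
  x≢y⇒x-y≢0 x≢y x-y≡0 = x≢y (x∙y⁻¹≈ε⇒x≈y _ _ x-y≡0)

  κ : ∀ {n} → ℕ → Polynomial n
  κ m = con (ℤ.+ m)

  fromℕ-*-vanishes : ∀ m {n} → fromℕ n ≡ 0# → fromℕ (m ℕ.* n) ≡ 0#
  fromℕ-*-vanishes m {n} n≡0 = trans (fromℕ-* m n) (trans (cong (fromℕ m *_) n≡0) (zeroʳ _))

  fromℕ-^-vanishes : ∀ p k → fromℕ (p ^ k) ≡ 0# → fromℕ p ≡ 0#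
  fromℕ-^-vanishes p ℕ.zero    1≡0 = ⊥-elim (1≢0 1≡0)
  fromℕ-^-vanishes p (ℕ.suc k) pᵏ⁺¹≡0 with x*y≡0⇒x≡0⊎y≡0 (trans (sym (fromℕ-* p (p ^ k))) pᵏ⁺¹≡0)
  ... | inj₁ p≡0  = p≡0
  ... | inj₂ pᵏ≡0 = fromℕ-^-vanishes p k pᵏ≡0

  bézout⇒1≡0 : ∀ x y {m n} → fromℕ m ≡ 0# → fromℕ n ≡ 0# → 1 ℕ.+ x ℕ.* m ≡ y ℕ.* n → 1# ≡ 0#
  bézout⇒1≡0 x y {m} {n} m≡0 n≡0 eq = begin
    1#                           ≡⟨ +-identityʳ 1# ⟨
    1# + 0#                      ≡⟨ cong (1# +_) (fromℕ-*-vanishes x m≡0) ⟨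
    1# + fromℕ (x ℕ.* m)         ≡⟨ fromℕ-+ 1 (x ℕ.* m) ⟨
    fromℕ (1 ℕ.+ x ℕ.* m)        ≡⟨ cong fromℕ eq ⟩
    fromℕ (y ℕ.* n)              ≡⟨ fromℕ-*-vanishes y n≡0 ⟩
    0#                           ∎

  coprime⇒¬both-vanish : ∀ {m n} → Coprime m n → fromℕ m ≡ 0# → fromℕ n ≡ 0# → ⊥
  coprime⇒¬both-vanish m⊥n m≡0 n≡0 with coprime-Bézout m⊥n
  ... | Bézout.+- x y 1+yn≡xm = 1≢0 (bézout⇒1≡0 y x n≡0 m≡0 1+yn≡xm)
  ... | Bézout.-+ x y 1+xm≡yn = 1≢0 (bézout⇒1≡0 x y m≡0 n≡0 1+xm≡yn)

  size-vanishes : ∀ {q} → HasSize F q → fromℕ q ≡ 0#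
  size-vanishes {q} F↔Fin[q] = identityʳ-unique (sum g) (fromℕ q) (sym (begin
    sum g                                 ≡⟨ ∑-permute g shift ⟩
    sum (λ i → g (Inverse.to shift i))    ≡⟨ sum-cong-≗ (λ i → Inverse.strictlyInverseʳ F↔Fin[q] (g i + 1#)) ⟩
    sum (λ i → g i + 1#)                  ≡⟨ ∑-distrib-+ {q} g (λ _ → 1#) ⟩
    sum g + sum {q} (λ _ → 1#)            ≡⟨ cong (sum g +_) (trans (sum-replicate q) (×ᵤ≈× q 1#)) ⟩
    sum g + fromℕ q                       ∎))
    where
    open import Algebra.Properties.CommutativeMonoid.Sum +-commutativeMonoid
      using (sum; ∑-permute; ∑-distrib-+; sum-cong-≗; sum-replicate)
    open import Algebra.Properties.Monoid.Mult.TCOptimised (CommutativeRing.+-monoid commutativeRing) using (×ᵤ≈×)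
    g : Fin q → Carrier
    g = Inverse.from F↔Fin[q]
    +1 : Carrier ↔ Carrier
    +1 = mk↔ₛ′ (_+ 1#) (_- 1#) (λ x → shift-back x (-‿inverseˡ 1#)) (λ x → shift-back x (-‿inverseʳ 1#))
      where
      shift-back : ∀ x {y z} → y + z ≡ 0# → x + y + z ≡ x
      shift-back x {y} {z} y+z≡0 = trans (+-assoc x y z) (trans (cong (x +_) y+z≡0) (+-identityʳ x))
    shift : Fin q ↔ Fin q
    shift = ↔-trans (↔-sym F↔Fin[q]) (↔-trans +1 F↔Fin[q])

  -- Matching on 0↦1 or 1↦0 substitutes the point into the goal, so the case lemmas below are
  -- stated at concrete points.
  infix 4 _↦_
  data _↦_ : Carrier → Carrier → Set where
    0↦1   : 0# ↦ 1#
    1↦0   : 1# ↦ 0#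
    x↦x⁻¹ : ∀ {x y} → x ≢ 0# → x ≢ 1# → x * y ≡ 1# → x ↦ y

  ↦fmap : ∀ x → x ↦ fmap F x
  ↦fmap x with x ≟ 0#
  ... | yes refl = 0↦1
  ... | no x≢0 with x ≟ 1#
  ...   | yes refl = 1↦0
  ...   | no x≢1   = x↦x⁻¹ x≢0 x≢1 (proj₂ (inverse x x≢0))

  fmap-0 : fmap F 0# ≡ 1#
  fmap-0 with 0# ≟ 0#
  ... | yes _   = refl
  ... | no 0≢0  = ⊥-elim (0≢0 refl)

  fmap-1 : fmap F 1# ≡ 0#
  fmap-1 with 1# ≟ 0#
  ... | yes 1≡0 = ⊥-elim (1≢0 1≡0)
  ... | no _ with 1# ≟ 1#
  ...   | yes _   = refl
  ...   | no 1≢1  = ⊥-elim (1≢1 refl)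

  fmap-inverse : ∀ {x} → x ≢ 0# → x ≢ 1# → x * fmap F x ≡ 1#
  fmap-inverse {x} x≢0 x≢1 with x ≟ 0#
  ... | yes x≡0 = ⊥-elim (x≢0 x≡0)
  ... | no x≢0′ with x ≟ 1#
  ...   | yes x≡1 = ⊥-elim (x≢1 x≡1)
  ...   | no _    = proj₂ (inverse x x≢0′)

  fmap-inverse-of-solution : ∀ {k x m} → k * x ≡ m → m ≢ 0# → k ≢ m → x * fmap F x ≡ 1#
  fmap-inverse-of-solution {k} kx≡m m≢0 k≢m = fmap-inverse x≢0 x≢1
    where
    x≢0 : _ ≢ 0#
    x≢0 refl = m≢0 (trans (sym kx≡m) (zeroʳ k))
    x≢1 : _ ≢ 1#
    x≢1 refl = k≢m (trans (sym (*-identityʳ k)) kx≡m)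

  ExceptionalAP : Carrier → Carrier → Carrier → Set
  ExceptionalAP a b c = (3# ≡ 0# × OrderingOfMinus1-0-1 F a b c) ⊎ (3# ≢ 0# × Exceptional>3 F a b c)

  ordering-reverse : ∀ {a b c} → OrderingOfMinus1-0-1 F c b a → OrderingOfMinus1-0-1 F a b c
  ordering-reverse (⟨-1,0,1⟩ (c , b , a)) = ⟨1,0,-1⟩ (a , b , c)
  ordering-reverse (⟨-1,1,0⟩ (c , b , a)) = ⟨0,1,-1⟩ (a , b , c)
  ordering-reverse (⟨0,-1,1⟩ (c , b , a)) = ⟨1,-1,0⟩ (a , b , c)
  ordering-reverse (⟨0,1,-1⟩ (c , b , a)) = ⟨-1,1,0⟩ (a , b , c)
  ordering-reverse (⟨1,-1,0⟩ (c , b , a)) = ⟨0,-1,1⟩ (a , b , c)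
  ordering-reverse (⟨1,0,-1⟩ (c , b , a)) = ⟨-1,0,1⟩ (a , b , c)

  exceptional>3-reverse : ∀ {a b c} → Exceptional>3 F c b a → Exceptional>3 F a b c
  exceptional>3-reverse (⟨0,3/2,3⟩ (c , b , a))   = ⟨3,3/2,0⟩ (a , b , c)
  exceptional>3-reverse (⟨3,3/2,0⟩ (c , b , a))   = ⟨0,3/2,3⟩ (a , b , c)
  exceptional>3-reverse (⟨1/3,2/3,1⟩ (c , b , a)) = ⟨1,2/3,1/3⟩ (a , b , c)
  exceptional>3-reverse (⟨1,2/3,1/3⟩ (c , b , a)) = ⟨1/3,2/3,1⟩ (a , b , c)

  exceptionalAP-reverse : ∀ {a b c} → ExceptionalAP c b a → ExceptionalAP a b c
  exceptionalAP-reverse (inj₁ (3≡0 , o)) = inj₁ (3≡0 , ordering-reverse o)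
  exceptionalAP-reverse (inj₂ (3≢0 , e)) = inj₂ (3≢0 , exceptional>3-reverse e)

  midpoint-sym : ∀ {x y z} → x + z ≡ 2# * y → z + x ≡ 2# * y
  midpoint-sym {x} {z = z} = trans (+-comm z x)

  preserved-0-1-c : ∀ {c w} → c * w ≡ 1# → 0# + c ≡ 2# * 1# → 1# + w ≡ 2# * 0# → ExceptionalAP 0# 1# c
  preserved-0-1-c {c} {w} cw≡1 ap nd = inj₁ (3≡0 , ⟨0,1,-1⟩ (refl , refl , c≡-1))
    where
    3≡0 : 3# ≡ 0#
    3≡0 = by-combination
      (solve 2 (λ c w → κ 3 :- κ 0 := w :* ((κ 0 :+ c) :- κ 2 :* κ 1) :+ κ 2 :* ((κ 1 :+ w) :- κ 2 :* κ 0) :- (c :* w :- κ 1)) refl c w)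
      (w ⊛ δ ap ⊕ 2# ⊛ δ nd ⊝ δ cw≡1)
    c≡-1 : c ≡ - 1#
    c≡-1 = by-combination (solve 1 (λ c → c :- :- κ 1 := ((κ 0 :+ c) :- κ 2 :* κ 1) :+ (κ 3 :- κ 0)) refl c) (δ ap ⊕ δ 3≡0)

  preserved-0-b-1 : ∀ {b v} → b * v ≡ 1# → 0# + 1# ≡ 2# * b → 1# + 0# ≡ 2# * v → ExceptionalAP 0# b 1#
  preserved-0-b-1 {b} {v} bv≡1 ap nd = inj₁ (3≡0 , ⟨0,-1,1⟩ (refl , b≡-1 , refl))
    where
    3≡0 : 3# ≡ 0#
    3≡0 = by-combination
      (solve 2 (λ b v → κ 3 :- κ 0 := :- (κ 4 :* (b :* v :- κ 1)) :- ((κ 1 :+ κ 0) :- κ 2 :* v) :- (κ 2 :* v) :* ((κ 0 :+ κ 1) :- κ 2 :* b)) refl b v)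
      (⊖ (fromℕ 4 ⊛ δ bv≡1) ⊝ δ nd ⊝ (2# * v) ⊛ δ ap)
    b≡-1 : b ≡ - 1#
    b≡-1 = by-combination (solve 1 (λ b → b :- :- κ 1 := b :* (κ 3 :- κ 0) :+ ((κ 0 :+ κ 1) :- κ 2 :* b)) refl b) (b ⊛ δ 3≡0 ⊕ δ ap)

  preserved-1-0-c : ∀ {c w} → c * w ≡ 1# → 1# + c ≡ 2# * 0# → 0# + w ≡ 2# * 1# → ExceptionalAP 1# 0# c
  preserved-1-0-c {c} {w} cw≡1 ap nd = inj₁ (3≡0 , ⟨1,0,-1⟩ (refl , refl , c≡-1))
    where
    3≡0 : 3# ≡ 0#
    3≡0 = by-combination
      (solve 2 (λ c w → κ 3 :- κ 0 := w :* ((κ 1 :+ c) :- κ 2 :* κ 0) :- ((κ 0 :+ w) :- κ 2 :* κ 1) :- (c :* w :- κ 1)) refl c w)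
      (w ⊛ δ ap ⊝ δ nd ⊝ δ cw≡1)
    c≡-1 : c ≡ - 1#
    c≡-1 = by-combination (solve 1 (λ c → c :- :- κ 1 := (κ 1 :+ c) :- κ 2 :* κ 0) refl c) (δ ap)

  module _ (2≢0 : 2# ≢ 0#) where

    preserved-0-b-c : ∀ {b c v w} → b ≢ 0# → b * v ≡ 1# → c * w ≡ 1# →
                      0# + c ≡ 2# * b → 1# + w ≡ 2# * v → ExceptionalAP 0# b c
    preserved-0-b-c {b} {c} {v} {w} b≢0 bv≡1 cw≡1 ap nd = inj₂ (3≢0 , ⟨0,3/2,3⟩ (refl , 2b≡3 , c≡3))
      where
      2b≡3 : 2# * b ≡ 3#
      2b≡3 = by-combination
        (solve 4 (λ b c v w → κ 2 :* b :- κ 3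
                   := κ 4 :* (b :* v :- κ 1) :- (c :* w :- κ 1) :+ (κ 2 :* b) :* ((κ 1 :+ w) :- κ 2 :* v) :+ w :* ((κ 0 :+ c) :- κ 2 :* b))
               refl b c v w)
        (fromℕ 4 ⊛ δ bv≡1 ⊝ δ cw≡1 ⊕ (2# * b) ⊛ δ nd ⊕ w ⊛ δ ap)
      c≡3 : c ≡ 3#
      c≡3 = by-combination (solve 2 (λ b c → c :- κ 3 := ((κ 0 :+ c) :- κ 2 :* b) :+ (κ 2 :* b :- κ 3)) refl b c) (δ ap ⊕ δ 2b≡3)
      3≢0 : 3# ≢ 0#
      3≢0 3≡0 = x*y≢0 2≢0 b≢0 (trans 2b≡3 3≡0)

    preserved-1-b-c : ∀ {b c v w} → b * v ≡ 1# → c * w ≡ 1# →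
                      1# + c ≡ 2# * b → 0# + w ≡ 2# * v → ExceptionalAP 1# b c
    preserved-1-b-c {b} {c} {v} {w} bv≡1 cw≡1 ap nd = inj₂ (3≢0 , ⟨1,2/3,1/3⟩ (refl , 3b≡2 , 3c≡1))
      where
      2c≡b : 2# * c ≡ b
      2c≡b = by-combination
        (solve 4 (λ b c v w → κ 2 :* c :- b
                   := b :* (c :* w :- κ 1) :- (κ 2 :* c) :* (b :* v :- κ 1) :- (b :* c) :* ((κ 0 :+ w) :- κ 2 :* v))
               refl b c v w)
        (b ⊛ δ cw≡1 ⊝ (2# * c) ⊛ δ bv≡1 ⊝ (b * c) ⊛ δ nd)
      3c≡1 : 3# * c ≡ 1#
      3c≡1 = by-combination (solve 2 (λ b c → κ 3 :* c :- κ 1 := κ 2 :* (κ 2 :* c :- b) :- ((κ 1 :+ c) :- κ 2 :* b)) refl b c)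
               (2# ⊛ δ 2c≡b ⊝ δ ap)
      3b≡2 : 3# * b ≡ 2#
      3b≡2 = by-combination (solve 2 (λ b c → κ 3 :* b :- κ 2 := (κ 2 :* c :- b) :- κ 2 :* ((κ 1 :+ c) :- κ 2 :* b)) refl b c)
               (δ 2c≡b ⊝ 2# ⊛ δ ap)
      3≢0 : 3# ≢ 0#
      3≢0 3≡0 = 1≢0 (trans (sym 3c≡1) (trans (cong (_* c) 3≡0) (zeroˡ c)))

    ¬preserved-a-0-c : ∀ {a c u w} → a ≢ 0# → a * u ≡ 1# → c * w ≡ 1# → a + c ≡ 2# * 0# → u + w ≡ 2# * 1# → ⊥
    ¬preserved-a-0-c {a} {c} {u} {w} a≢0 au≡1 cw≡1 ap nd = x*y≢0 2≢0 a≢0 (by-combination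
      (solve 4 (λ a c u w → κ 2 :* a :- κ 0
                 := (a :* u :- κ 1) :- (c :* w :- κ 1) :+ w :* ((a :+ c) :- κ 2 :* κ 0) :- a :* ((u :+ w) :- κ 2 :* κ 1))
             refl a c u w)
      (δ au≡1 ⊝ δ cw≡1 ⊕ w ⊛ δ ap ⊝ a ⊛ δ nd))

    ¬preserved-a-1-c : ∀ {a c u w} → a * u ≡ 1# → c * w ≡ 1# → a + c ≡ 2# * 1# → u + w ≡ 2# * 0# → ⊥
    ¬preserved-a-1-c {a} {c} {u} {w} au≡1 cw≡1 ap nd = 2≢0 (by-combination
      (solve 4 (λ a c u w → κ 2 :- κ 0
                 := (a :* c) :* ((u :+ w) :- κ 2 :* κ 0) :- c :* (a :* u :- κ 1) :- a :* (c :* w :- κ 1) :- ((a :+ c) :- κ 2 :* κ 1))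
             refl a c u w)
      ((a * c) ⊛ δ nd ⊝ c ⊛ δ au≡1 ⊝ a ⊛ δ cw≡1 ⊝ δ ap))

    ¬preserved-a-b-c : ∀ {a b c u v w} → b - a ≢ 0# → a * u ≡ 1# → b * v ≡ 1# → c * w ≡ 1# →
                       a + c ≡ 2# * b → u + w ≡ 2# * v → ⊥
    ¬preserved-a-b-c {a} {b} {c} {u} {v} {w} b-a≢0 au≡1 bv≡1 cw≡1 ap nd = x*y≢0 (x*y≢0 2≢0 b-a≢0) b-a≢0 (by-combination
      (solve 6 (λ a b c u v w → (κ 2 :* (b :- a)) :* (b :- a) :- κ 0
                 := (a :* b :* c) :* ((u :+ w) :- κ 2 :* v) :+ (κ 2 :* a :- b) :* ((a :+ c) :- κ 2 :* b)
                    :- (b :* c) :* (a :* u :- κ 1) :- (a :* b) :* (c :* w :- κ 1) :+ (κ 2 :* a :* c) :* (b :* v :- κ 1))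
             refl a b c u v w)
      ((a * b * c) ⊛ δ nd ⊕ (2# * a - b) ⊛ δ ap ⊝ (b * c) ⊛ δ au≡1 ⊝ (a * b) ⊛ δ cw≡1 ⊕ (2# * a * c) ⊛ δ bv≡1))

    midpoint⇒b≢c : ∀ {a b c} → a ≢ b → a + c ≡ 2# * b → b ≢ c
    midpoint⇒b≢c {a} {b} a≢b ap refl = a≢b (by-combination (solve 2 (λ a b → a :- b := (a :+ b) :- κ 2 :* b) refl a b) (δ ap))

    midpoint⇒a≢c : ∀ {a b c} → a ≢ b → a + c ≡ 2# * b → a ≢ c
    midpoint⇒a≢c {a} {b} a≢b ap refl = x*y≢0 2≢0 (x≢y⇒x-y≢0 a≢b)
      (by-combination (solve 2 (λ a b → κ 2 :* (a :- b) :- κ 0 := (a :+ a) :- κ 2 :* b) refl a b) (δ ap))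

    preserved⇒exceptional : ∀ {a b c u v w} → a ↦ u → b ↦ v → c ↦ w →
                            a ≢ b → a + c ≡ 2# * b → u + w ≡ 2# * v → ExceptionalAP a b c
    preserved⇒exceptional 0↦1 0↦1 _   a≢b _  _ = ⊥-elim (a≢b refl)
    preserved⇒exceptional 1↦0 1↦0 _   a≢b _  _ = ⊥-elim (a≢b refl)
    preserved⇒exceptional _   0↦1 0↦1 a≢b ap _ = ⊥-elim (midpoint⇒b≢c a≢b ap refl)
    preserved⇒exceptional _   1↦0 1↦0 a≢b ap _ = ⊥-elim (midpoint⇒b≢c a≢b ap refl)
    preserved⇒exceptional 0↦1 _   0↦1 a≢b ap _ = ⊥-elim (midpoint⇒a≢c a≢b ap refl)
    preserved⇒exceptional 1↦0 _   1↦0 a≢b ap _ = ⊥-elim (midpoint⇒a≢c a≢b ap refl)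
    preserved⇒exceptional 0↦1 1↦0 (x↦x⁻¹ _ _ cw≡1) _ ap nd = preserved-0-1-c cw≡1 ap nd
    preserved⇒exceptional 0↦1 (x↦x⁻¹ _ _ bv≡1) 1↦0 _ ap nd = preserved-0-b-1 bv≡1 ap nd
    preserved⇒exceptional 1↦0 0↦1 (x↦x⁻¹ _ _ cw≡1) _ ap nd = preserved-1-0-c cw≡1 ap nd
    preserved⇒exceptional 0↦1 (x↦x⁻¹ b≢0 _ bv≡1) (x↦x⁻¹ _ _ cw≡1) _ ap nd = preserved-0-b-c b≢0 bv≡1 cw≡1 ap nd
    preserved⇒exceptional 1↦0 (x↦x⁻¹ _ _ bv≡1) (x↦x⁻¹ _ _ cw≡1) _ ap nd = preserved-1-b-c bv≡1 cw≡1 ap nd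
    preserved⇒exceptional (x↦x⁻¹ _ _ au≡1) 1↦0 0↦1 _ ap nd =
      exceptionalAP-reverse (preserved-0-1-c au≡1 (midpoint-sym ap) (midpoint-sym nd))
    preserved⇒exceptional 1↦0 (x↦x⁻¹ _ _ bv≡1) 0↦1 _ ap nd =
      exceptionalAP-reverse (preserved-0-b-1 bv≡1 (midpoint-sym ap) (midpoint-sym nd))
    preserved⇒exceptional (x↦x⁻¹ _ _ au≡1) 0↦1 1↦0 _ ap nd =
      exceptionalAP-reverse (preserved-1-0-c au≡1 (midpoint-sym ap) (midpoint-sym nd))
    preserved⇒exceptional (x↦x⁻¹ _ _ au≡1) (x↦x⁻¹ b≢0 _ bv≡1) 0↦1 _ ap nd =
      exceptionalAP-reverse (preserved-0-b-c b≢0 bv≡1 au≡1 (midpoint-sym ap) (midpoint-sym nd))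
    preserved⇒exceptional (x↦x⁻¹ _ _ au≡1) (x↦x⁻¹ _ _ bv≡1) 1↦0 _ ap nd =
      exceptionalAP-reverse (preserved-1-b-c bv≡1 au≡1 (midpoint-sym ap) (midpoint-sym nd))
    preserved⇒exceptional (x↦x⁻¹ a≢0 _ au≡1) 0↦1 (x↦x⁻¹ _ _ cw≡1) _ ap nd =
      ⊥-elim (¬preserved-a-0-c a≢0 au≡1 cw≡1 ap nd)
    preserved⇒exceptional (x↦x⁻¹ _ _ au≡1) 1↦0 (x↦x⁻¹ _ _ cw≡1) _ ap nd =
      ⊥-elim (¬preserved-a-1-c au≡1 cw≡1 ap nd)
    preserved⇒exceptional (x↦x⁻¹ _ _ au≡1) (x↦x⁻¹ _ _ bv≡1) (x↦x⁻¹ _ _ cw≡1) a≢b ap nd =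
      ⊥-elim (¬preserved-a-b-c (x≢y⇒x-y≢0 (≢-sym a≢b)) au≡1 bv≡1 cw≡1 ap nd)

    3≢1 : 3# ≢ 1#
    3≢1 3≡1 = 2≢0 (by-combination (solve 0 (κ 2 :- κ 0 := κ 3 :- κ 1) refl) (δ 3≡1))

    fmap-[-1] : fmap F (- 1#) ≡ - 1#
    fmap-[-1] = by-combination (solve 1 (λ y → y :- :- κ 1 := :- (:- κ 1 :* y :- κ 1)) refl _) (⊖ δ (fmap-inverse -1≢0 -1≢1))
      where
      -1≢0 : - 1# ≢ 0#
      -1≢0 -1≡0 = 1≢0 (by-combination (solve 0 (κ 1 :- κ 0 := :- (:- κ 1 :- κ 0)) refl) (⊖ δ -1≡0))
      -1≢1 : - 1# ≢ 1#
      -1≢1 -1≡1 = 2≢0 (by-combination (solve 0 (κ 2 :- κ 0 := :- (:- κ 1 :- κ 1)) refl) (⊖ δ -1≡1))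

    preserved-[-1,0,1] : 3# ≡ 0# → fmap F (- 1#) + fmap F 1# ≡ 2# * fmap F 0#
    preserved-[-1,0,1] 3≡0 rewrite fmap-[-1] | fmap-1 | fmap-0 =
      by-combination (solve 0 ((:- κ 1 :+ κ 0) :- κ 2 :* κ 1 := :- (κ 3 :- κ 0)) refl) (⊖ δ 3≡0)

    preserved-[-1,1,0] : fmap F (- 1#) + fmap F 0# ≡ 2# * fmap F 1#
    preserved-[-1,1,0] rewrite fmap-[-1] | fmap-1 | fmap-0 =
      by-combination (solve 0 ((:- κ 1 :+ κ 1) :- κ 2 :* κ 0 := κ 0) refl) refl

    preserved-[0,-1,1] : 3# ≡ 0# → fmap F 0# + fmap F 1# ≡ 2# * fmap F (- 1#)
    preserved-[0,-1,1] 3≡0 rewrite fmap-[-1] | fmap-1 | fmap-0 =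
      by-combination (solve 0 ((κ 1 :+ κ 0) :- κ 2 :* :- κ 1 := κ 3 :- κ 0) refl) (δ 3≡0)

    preserved-[0,3/2,3] : ∀ {b} → 3# ≢ 0# → 2# * b ≡ 3# → fmap F 0# + fmap F 3# ≡ 2# * fmap F b
    preserved-[0,3/2,3] {b} 3≢0 2b≡3 rewrite fmap-0 = by-scaled-combination 3≢0
      (solve 3 (λ b v w → κ 3 :* ((κ 1 :+ w) :- κ 2 :* v)
                 := (κ 3 :* w :- κ 1) :- κ 4 :* (b :* v :- κ 1) :+ (κ 2 :* v) :* (κ 2 :* b :- κ 3))
             refl b (fmap F b) (fmap F 3#))
      (δ 3w≡1 ⊝ fromℕ 4 ⊛ δ bv≡1 ⊕ (2# * fmap F b) ⊛ δ 2b≡3)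
      where
      3w≡1 : 3# * fmap F 3# ≡ 1#
      3w≡1 = fmap-inverse 3≢0 3≢1
      bv≡1 : b * fmap F b ≡ 1#
      bv≡1 = fmap-inverse-of-solution 2b≡3 3≢0 x≢x+1

    preserved-[1/3,2/3,1] : ∀ {a b} → 3# * a ≡ 1# → 3# * b ≡ 2# → fmap F a + fmap F 1# ≡ 2# * fmap F b
    preserved-[1/3,2/3,1] {a} {b} 3a≡1 3b≡2 rewrite fmap-1 = by-combination
      (solve 4 (λ a b u v → (u :+ κ 0) :- κ 2 :* v
                 := κ 3 :* (a :* u :- κ 1) :- u :* (κ 3 :* a :- κ 1) :- κ 3 :* (b :* v :- κ 1) :+ v :* (κ 3 :* b :- κ 2))
             refl a b (fmap F a) (fmap F b))
      (3# ⊛ δ au≡1 ⊝ fmap F a ⊛ δ 3a≡1 ⊝ 3# ⊛ δ bv≡1 ⊕ fmap F b ⊛ δ 3b≡2)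
      where
      au≡1 : a * fmap F a ≡ 1#
      au≡1 = fmap-inverse-of-solution 3a≡1 1≢0 3≢1
      bv≡1 : b * fmap F b ≡ 1#
      bv≡1 = fmap-inverse-of-solution 3b≡2 2≢0 (≢-sym x≢x+1)

    exceptional⇒preserved : ∀ {a b c} → ExceptionalAP a b c → fmap F a + fmap F c ≡ 2# * fmap F b
    exceptional⇒preserved (inj₁ (3≡0 , ⟨-1,0,1⟩ (refl , refl , refl))) = preserved-[-1,0,1] 3≡0
    exceptional⇒preserved (inj₁ (3≡0 , ⟨1,0,-1⟩ (refl , refl , refl))) = midpoint-sym (preserved-[-1,0,1] 3≡0)
    exceptional⇒preserved (inj₁ (_   , ⟨-1,1,0⟩ (refl , refl , refl))) = preserved-[-1,1,0]
    exceptional⇒preserved (inj₁ (_   , ⟨0,1,-1⟩ (refl , refl , refl))) = midpoint-sym preserved-[-1,1,0]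
    exceptional⇒preserved (inj₁ (3≡0 , ⟨0,-1,1⟩ (refl , refl , refl))) = preserved-[0,-1,1] 3≡0
    exceptional⇒preserved (inj₁ (3≡0 , ⟨1,-1,0⟩ (refl , refl , refl))) = midpoint-sym (preserved-[0,-1,1] 3≡0)
    exceptional⇒preserved (inj₂ (3≢0 , ⟨0,3/2,3⟩ (refl , 2b≡3 , refl))) = preserved-[0,3/2,3] 3≢0 2b≡3
    exceptional⇒preserved (inj₂ (3≢0 , ⟨3,3/2,0⟩ (refl , 2b≡3 , refl))) = midpoint-sym (preserved-[0,3/2,3] 3≢0 2b≡3)
    exceptional⇒preserved (inj₂ (_ , ⟨1/3,2/3,1⟩ (3a≡1 , 3b≡2 , refl))) = preserved-[1/3,2/3,1] 3a≡1 3b≡2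
    exceptional⇒preserved (inj₂ (_ , ⟨1,2/3,1/3⟩ (refl , 3b≡2 , 3c≡1))) = midpoint-sym (preserved-[1/3,2/3,1] 3c≡1 3b≡2)

    preserved⇔exceptional : ∀ {a b c} → b - a ≢ 0# → a + c ≡ 2# * b →
                            (fmap F a + fmap F c ≡ 2# * fmap F b) ⇔ ExceptionalAP a b c
    preserved⇔exceptional {a} {b} {c} b-a≢0 ap =
      mk⇔ (preserved⇒exceptional (↦fmap a) (↦fmap b) (↦fmap c) (λ a≡b → b-a≢0 (δ (sym a≡b))) ap) exceptional⇒preserved

  difference⇔midpoint : ∀ {x y z} → y - x ≡ z - y ⇔ x + z ≡ 2# * y
  difference⇔midpoint {x} {y} {z} = mk⇔
    (λ e → by-combination (solve 3 (λ x y z → (x :+ z) :- κ 2 :* y := :- ((y :- x) :- (z :- y))) refl x y z) (⊖ δ e))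
    (λ e → by-combination (solve 3 (λ x y z → (y :- x) :- (z :- y) := :- ((x :+ z) :- κ 2 :* y)) refl x y z) (⊖ δ e))

  ¬destroys⇔preserved : ∀ {a b c} → (¬ Destroys F (fmap F) a b c) ⇔ (fmap F b - fmap F a ≡ fmap F c - fmap F b)
  ¬destroys⇔preserved = mk⇔ (decidable-stable (_ ≟ _)) (λ preserved destroys → destroys preserved)

  exceptionalAP⇔ : ∀ {p a b c} → Prime p → p ≢ 2 → fromℕ p ≡ 0# →
                   ExceptionalAP a b c ⇔ ((p ≡ 3 → OrderingOfMinus1-0-1 F a b c) × (p > 3 → Exceptional>3 F a b c))
  exceptionalAP⇔ {p} p-prime p≢2 p≡0 with p ℕ.≟ 3
  ... | yes refl = mk⇔
    (λ { (inj₁ (_ , o))   → (λ _ → o) , (λ 3>3 → ⊥-elim (ℕ.<-irrefl refl 3>3))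
       ; (inj₂ (3≢0 , _)) → ⊥-elim (3≢0 p≡0) })
    (λ (o , _) → inj₁ (p≡0 , o refl))
  ... | no p≢3 = mk⇔
    (λ { (inj₁ (3≡0 , _)) → ⊥-elim (3≢0 3≡0)
       ; (inj₂ (_ , e))   → (λ p≡3 → ⊥-elim (p≢3 p≡3)) , (λ _ → e) })
    (λ (_ , e) → inj₂ (3≢0 , e 3<p))
    where
    3<p : 3 ℕ.< p
    3<p = ℕ.≤∧≢⇒< (odd-prime⇒2<p p-prime p≢2) (≢-sym p≢3)
    3≢0 : 3# ≢ 0#
    3≢0 = coprime⇒¬both-vanish (prime⇒coprime p-prime 3<p) p≡0

lemma2p1 : (p k : ℕ) → Prime p → p ≢ 2 → k ≥ 1 →
    (F : Field) → HasSize F (p ^ k) →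
    (a b c : Field.Carrier F) → IsNonconstAP F a b c →
    ((¬ Destroys F (fmap F) a b c) ⇔
      ((p ≡ 3 → OrderingOfMinus1-0-1 F a b c) × (p > 3 → Exceptional>3 F a b c)))
lemma2p1 p k p-prime p≢2 _ F size a b c (b-a≡c-b , b-a≢0) =
  ¬destroys⇔preserved F ⟨ ⇔-trans ⟩
  difference⇔midpoint F ⟨ ⇔-trans ⟩
  preserved⇔exceptional F 2≢0 b-a≢0 (Equivalence.to (difference⇔midpoint F) b-a≡c-b) ⟨ ⇔-trans ⟩
  exceptionalAP⇔ F p-prime p≢2 p≡0
  where
  open Field F using (0#; 2#)
  p≡0 : fromℕ F p ≡ 0#
  p≡0 = fromℕ-^-vanishes F p k (size-vanishes F size)
  2≢0 : 2# ≢ 0#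
  2≢0 = coprime⇒¬both-vanish F (prime⇒coprime p-prime (odd-prime⇒2<p p-prime p≢2)) p≡0
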